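{- Let $n$ and $m$ be positive integers with $m\geq n+1$. The number of pointed $(n,m)$-lattice paths is $\binom{2n}{n}\binom{m}{n+1}$.
   Context: An $(n,m)$-lattice path is a sequence $P=(x_1,y_1)(x_2,y_2)\cdots(x_{n+1},y_{n+1})$ of vectors in $\mathbb{Z}^2$ such that $1-n\leq y_i\leq 1$ for all $i$, $\sum_{i=1}^{n+1}y_i=1$, $1\leq x_i\leq m-1$ for all $i$, and $\sum_{i=1}^{n+1}x_i=m$. A pointed $(n,m)$-lattice path is a pair $[P;j]$ where $P=(x_1,y_1)\cdots(x_{n+1},y_{n+1})$ is an $(n,m)$-lattice path and $j$ is an integer with $0\leq j\leq x_{n+1}-1$. -}

module Defs where

open import Data.Nat using (ℕ; suc)
open import Data.Integer using (ℤ; +_; _+_; _-_; _≤_; 0ℤ; 1ℤ)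
open import Data.Product using (Σ; _×_; proj₁; proj₂)
open import Data.Vec using (Vec; foldr; map; last)
open import Data.Vec.Relation.Unary.All using (All)
open import Relation.Binary.PropositionalEquality using (_≡_)

sumℤ : ∀ {k} → Vec ℤ k → ℤ
sumℤ = foldr _ _+_ 0ℤ

record LatticePath (n m : ℕ) : Set where
  field
    steps   : Vec (ℤ × ℤ) (suc n)
    y-bound : All (λ s → (1ℤ - + n ≤ proj₂ s) × (proj₂ s ≤ 1ℤ)) steps
    y-sum   : sumℤ (map proj₂ steps) ≡ 1ℤ
    x-bound : All (λ s → (1ℤ ≤ proj₁ s) × (proj₁ s ≤ + m - 1ℤ)) steps
    x-sum   : sumℤ (map proj₁ steps) ≡ + m

open LatticePath public

lastX : ∀ {n m} → LatticePath n m → ℤ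
lastX P = proj₁ (last (steps P))

PointedLatticePath : ℕ → ℕ → Set
PointedLatticePath n m =
  Σ (LatticePath n m) λ P → Σ ℤ λ j → (0ℤ ≤ j) × (j ≤ lastX P - 1ℤ)

-- The heights y and the pointed widths (x, j) of a pointed path are independent. Via
-- a_i = 1 - y_i the heights are the compositions of n into n + 1 nonnegative parts; the
-- lower bounds y_i ≥ 1 - n come for free since every part is at most the total n. Via
-- x_i - 1, with the last of these split further into x_{n+1} - 1 - j and j, the pointed
-- widths are the compositions of m - n - 1 into n + 2 nonnegative parts; the upper bounds
-- x_i ≤ m - 1 come for free since n ≥ 1. Stars and bars counts these as C(2n, n) and
-- C(m, n + 1).
module Submission where

open import Data.Nat as ℕ using (ℕ; zero; suc; _∸_; z≤n)
import Data.Nat.Properties as ℕP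
open import Data.Nat.Combinatorics using (_C_; nCn≡1; nCk+nC[k+1]≡[n+1]C[k+1])
open import Data.Integer as ℤ using (ℤ; +_; _+_; _-_; _≤_; 0ℤ; 1ℤ; ∣_∣; +≤+)
import Data.Integer.Properties as ℤP
open import Data.Integer.Tactic.RingSolver using (solve-∀)
open import Data.Fin as Fin using (Fin)
open import Data.Fin.Properties using (+↔⊎; *↔×)
open import Data.Vec using (Vec; []; _∷_; map; zip; last; sum)
open import Data.Vec.Properties using (map-∘; map-cong; map-id; map-proj₁-zip; map-proj₂-zip; map-<,>-zip)
open import Data.Vec.Relation.Unary.All as All using (All; []; _∷_)
import Data.Vec.Relation.Unary.All.Properties as AllP
open import Data.Product using (Σ; _×_; _,_; proj₁; proj₂; map₁; uncurry)
open import Data.Product.Properties using (Σ-≡,≡→≡)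
open import Data.Product.Function.Dependent.Propositional using (Σ-↔)
open import Data.Product.Function.NonDependent.Propositional using (_×-↔_)
open import Data.Sum using (_⊎_; inj₁; inj₂)
open import Data.Sum.Function.Propositional using (_⊎-↔_)
open import Function.Base using (_∘_)
open import Function.Bundles using (_↔_; _⇔_; mk↔ₛ′; mk⇔; Inverse; Equivalence)
open import Function.Properties.Inverse using (↔-refl)
open import Function.Related.Propositional using (module EquationalReasoning)
open import Axiom.UniquenessOfIdentityProofs using (module Decidable⇒UIP)
open import Relation.Nullary.Irrelevant using (Irrelevant)
open import Relation.Binary.PropositionalEquality
open import Defs

×-irrelevant : {A B : Set} → Irrelevant A → Irrelevant B → Irrelevant (A × B)
×-irrelevant A-irr B-irr (a , b) (a′ , b′) = cong₂ _,_ (A-irr a a′) (B-irr b b′)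

irrelevant-⇔⇒↔ : {A B : Set} → Irrelevant A → Irrelevant B → A ⇔ B → A ↔ B
irrelevant-⇔⇒↔ A-irr B-irr A⇔B = mk↔ₛ′ to from (λ _ → B-irr _ _) (λ _ → A-irr _ _)
  where open Equivalence A⇔B

Σ-↔-⇔ : {A B : Set} {P : A → Set} {Q : B → Set} →
        (∀ {a} → Irrelevant (P a)) → (∀ {b} → Irrelevant (Q b)) →
        (A↔B : A ↔ B) → (∀ {a} → P a ⇔ Q (Inverse.to A↔B a)) → Σ A P ↔ Σ B Q
Σ-↔-⇔ P-irr Q-irr A↔B P⇔Q = Σ-↔ A↔B (irrelevant-⇔⇒↔ P-irr Q-irr P⇔Q)

map-↔ : {A B : Set} {n : ℕ} → A ↔ B → Vec A n ↔ Vec B n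
map-↔ A↔B = mk↔ₛ′ (map to) (map from) (map-inverse strictlyInverseˡ) (map-inverse strictlyInverseʳ)
  where
  open Inverse A↔B
  map-inverse : ∀ {C D : Set} {n} {f : C → D} {g : D → C} →
                (∀ x → f (g x) ≡ x) → (v : Vec D n) → map f (map g v) ≡ v
  map-inverse {f = f} {g} f∘g v = trans (sym (map-∘ f g v)) (trans (map-cong f∘g v) (map-id v))

ℤ-≡-irrelevant : {i j : ℤ} → Irrelevant (i ≡ j)
ℤ-≡-irrelevant = Decidable⇒UIP.≡-irrelevant ℤ._≟_

≤×≤-irrelevant : {i j k l : ℤ} → Irrelevant (i ≤ j × k ≤ l)
≤×≤-irrelevant = ×-irrelevant ℤP.≤-irrelevant ℤP.≤-irrelevant

All×≡-irrelevant : {A : Set} {P : A → Set} {k : ℕ} {xs : Vec A k} {i j : ℤ} →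
                   (∀ {a} → Irrelevant (P a)) → Irrelevant (All P xs × i ≡ j)
All×≡-irrelevant P-irr = ×-irrelevant (All.irrelevant P-irr) ℤ-≡-irrelevant

last-map : {A B : Set} {k : ℕ} (f : A → B) (v : Vec A (suc k)) → last (map f v) ≡ f (last v)
last-map {k = zero}  f (x ∷ []) = refl
last-map {k = suc k} f (x ∷ v)  = last-map f v

unzip-↔ : {A B C : Set} {k : ℕ} → (Vec (A × B) k × C) ↔ (Vec B k × (Vec A k × C))
unzip-↔ = mk↔ₛ′ (λ (s , c) → map proj₂ s , map proj₁ s , c) (λ (bs , as , c) → zip as bs , c)
  (λ (bs , as , c) → cong₂ (λ bs′ as′ → bs′ , as′ , c) (map-proj₂-zip as bs) (map-proj₁-zip as bs))
  (λ (s , c) → cong (_, c) (trans (sym (map-<,>-zip proj₁ proj₂ s)) (map-id s)))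

Composition : ℕ → ℕ → Set
Composition k s = Σ (Vec ℕ k) (λ v → sum v ≡ s)

composition-one-part : ∀ s → Composition 1 s ↔ Fin 1
composition-one-part s = mk↔ₛ′ (λ _ → Fin.zero) (λ _ → (s ∷ []) , ℕP.+-identityʳ s)
  (λ { Fin.zero → refl ; (Fin.suc ()) })
  (λ { ((x ∷ []) , x+0≡s) →
        Σ-≡,≡→≡ (cong (_∷ []) (trans (sym x+0≡s) (ℕP.+-identityʳ x)) , ℕP.≡-irrelevant _ _) })

composition-zero : ∀ k → Composition (suc k) 0 ↔ Composition k 0
composition-zero k = mk↔ₛ′ drop-head prepend-zero (λ _ → refl) prepend-zero∘drop-head
  where
  drop-head : Composition (suc k) 0 → Composition k 0
  drop-head ((zero ∷ v) , p) = v , p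
  prepend-zero : Composition k 0 → Composition (suc k) 0
  prepend-zero (v , p) = (0 ∷ v) , p
  prepend-zero∘drop-head : ∀ c → prepend-zero (drop-head c) ≡ c
  prepend-zero∘drop-head ((zero ∷ v) , p) = refl

composition-head : ∀ k s → Composition (suc k) (suc s) ↔ (Composition k (suc s) ⊎ Composition (suc k) s)
composition-head k s = mk↔ₛ′ split join split∘join join∘split
  where
  split : Composition (suc k) (suc s) → Composition k (suc s) ⊎ Composition (suc k) s
  split ((zero ∷ v) , p)  = inj₁ (v , p)
  split ((suc a ∷ v) , p) = inj₂ ((a ∷ v) , ℕP.suc-injective p)
  join : Composition k (suc s) ⊎ Composition (suc k) s → Composition (suc k) (suc s)
  join (inj₁ (v , p))       = (0 ∷ v) , p
  join (inj₂ ((a ∷ v) , p)) = (suc a ∷ v) , cong suc p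
  split∘join : ∀ c → split (join c) ≡ c
  split∘join (inj₁ _)             = refl
  split∘join (inj₂ ((a ∷ v) , p)) = cong (λ q → inj₂ ((a ∷ v) , q)) (ℕP.≡-irrelevant _ _)
  join∘split : ∀ c → join (split c) ≡ c
  join∘split ((zero ∷ v) , p)  = refl
  join∘split ((suc a ∷ v) , p) = cong ((suc a ∷ v) ,_) (ℕP.≡-irrelevant _ _)

composition-count : ∀ k s → Composition (suc k) s ↔ Fin ((s ℕ.+ k) C k)
composition-count zero s = composition-one-part s
composition-count (suc k) zero = begin
  Composition (suc (suc k)) 0 ↔⟨ composition-zero (suc k) ⟩
  Composition (suc k) 0       ↔⟨ composition-count k 0 ⟩
  Fin (k C k)                 ≡⟨ cong Fin (trans (nCn≡1 k) (sym (nCn≡1 (suc k)))) ⟩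
  Fin (suc k C suc k)         ∎
  where open EquationalReasoning
composition-count (suc k) (suc s) = begin
  Composition (suc (suc k)) (suc s)
    ↔⟨ composition-head (suc k) s ⟩
  (Composition (suc k) (suc s) ⊎ Composition (suc (suc k)) s)
    ↔⟨ composition-count k (suc s) ⊎-↔ composition-count (suc k) s ⟩
  (Fin ((suc s ℕ.+ k) C k) ⊎ Fin ((s ℕ.+ suc k) C suc k))
    ↔⟨ +↔⊎ ⟨
  Fin ((suc s ℕ.+ k) C k ℕ.+ (s ℕ.+ suc k) C suc k)
    ≡⟨ cong Fin pascal ⟩
  Fin ((suc s ℕ.+ suc k) C suc k) ∎
  where
  open EquationalReasoning
  pascal : (suc s ℕ.+ k) C k ℕ.+ (s ℕ.+ suc k) C suc k ≡ (suc s ℕ.+ suc k) C suc k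
  pascal = trans (cong (λ t → t C k ℕ.+ (s ℕ.+ suc k) C suc k) (sym (ℕP.+-suc s k)))
                 (nCk+nC[k+1]≡[n+1]C[k+1] (s ℕ.+ suc k) k)

i-j+j≡i : ∀ i j → i - j + j ≡ i
i-j+j≡i = solve-∀

i+j-j≡i : ∀ i j → i + j - j ≡ i
i+j-j≡i = solve-∀

sumℤ-map-+ : ∀ {k} (v : Vec ℕ k) → sumℤ (map +_ v) ≡ + sum v
sumℤ-map-+ []      = refl
sumℤ-map-+ (x ∷ v) = cong (_+_ (+ x)) (sumℤ-map-+ v)

sumℤ-nonneg : ∀ {k} {v : Vec ℤ k} → All (0ℤ ≤_) v → 0ℤ ≤ sumℤ v
sumℤ-nonneg []       = ℤP.≤-refl
sumℤ-nonneg (p ∷ ps) = ℤP.+-mono-≤ p (sumℤ-nonneg ps)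

All-≤-sumℤ : ∀ {k} {v : Vec ℤ k} → All (0ℤ ≤_) v → All (_≤ sumℤ v) v
All-≤-sumℤ []                  = []
All-≤-sumℤ {v = x ∷ v} (0≤x ∷ 0≤v) = x≤x+S ∷ All.map (λ y≤S → ℤP.≤-trans y≤S S≤x+S) (All-≤-sumℤ 0≤v)
  where
  x≤x+S : x ≤ x + sumℤ v
  x≤x+S = subst (_≤ x + sumℤ v) (ℤP.+-identityʳ x) (ℤP.+-monoʳ-≤ x (sumℤ-nonneg 0≤v))
  S≤x+S : sumℤ v ≤ x + sumℤ v
  S≤x+S = subst (_≤ x + sumℤ v) (ℤP.+-identityˡ (sumℤ v)) (ℤP.+-monoˡ-≤ (sumℤ v) 0≤x)

sumℤ-map-1- : ∀ {k} (v : Vec ℤ k) → sumℤ (map (1ℤ -_) v) ≡ + k - sumℤ v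
sumℤ-map-1- []      = refl
sumℤ-map-1- (y ∷ v) = trans (cong (_+_ (1ℤ - y)) (sumℤ-map-1- v)) (regroup y (sumℤ v) (+ _))
  where
  regroup : ∀ y S K → (1ℤ - y) + (K - S) ≡ (1ℤ + K) - (y + S)
  regroup = solve-∀

sumℤ-map-‿-1 : ∀ {k} (v : Vec ℤ k) → sumℤ (map (_- 1ℤ) v) ≡ sumℤ v - + k
sumℤ-map-‿-1 []      = refl
sumℤ-map-‿-1 (x ∷ v) = trans (cong (_+_ (x - 1ℤ)) (sumℤ-map-‿-1 v)) (regroup x (sumℤ v) (+ _))
  where
  regroup : ∀ x S K → (x - 1ℤ) + (S - K) ≡ (x + S) - (1ℤ + K)
  regroup = solve-∀

IsComposition : ℕ → ∀ {k} → Vec ℤ k → Set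
IsComposition s v = All (0ℤ ≤_) v × sumℤ v ≡ + s

IsComposition-irrelevant : ∀ s {k} {v : Vec ℤ k} → Irrelevant (IsComposition s v)
IsComposition-irrelevant s = All×≡-irrelevant ℤP.≤-irrelevant

IsComposition⇒bounded : ∀ {s k} {v : Vec ℤ k} → IsComposition s v → All (λ x → 0ℤ ≤ x × x ≤ + s) v
IsComposition⇒bounded {v = v} (nonneg , Σv≡s) =
  All.zip (nonneg , subst (λ t → All (_≤ t) v) Σv≡s (All-≤-sumℤ nonneg))

map-+-∣∣ : ∀ {k} {v : Vec ℤ k} → All (0ℤ ≤_) v → map +_ (map ∣_∣ v) ≡ v
map-+-∣∣ []       = refl
map-+-∣∣ (p ∷ ps) = cong₂ _∷_ (ℤP.0≤i⇒+∣i∣≡i p) (map-+-∣∣ ps)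

ℤ-composition↔composition : ∀ s {k} → Σ (Vec ℤ k) (IsComposition s) ↔ Composition k s
ℤ-composition↔composition s {k} = mk↔ₛ′ toℕ fromℕ toℕ∘fromℕ fromℕ∘toℕ
  where
  toℕ : Σ (Vec ℤ k) (IsComposition s) → Composition k s
  toℕ (v , nonneg , Σv≡s) = map ∣_∣ v , ℤP.+-injective (begin
    + sum (map ∣_∣ v)          ≡⟨ sumℤ-map-+ (map ∣_∣ v) ⟨
    sumℤ (map +_ (map ∣_∣ v)) ≡⟨ cong sumℤ (map-+-∣∣ nonneg) ⟩
    sumℤ v                    ≡⟨ Σv≡s ⟩
    + s                       ∎)
    where open ≡-Reasoning
  fromℕ : Composition k s → Σ (Vec ℤ k) (IsComposition s)
  fromℕ (c , Σc≡s) =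
    map +_ c , AllP.map⁺ (All.universal (λ _ → +≤+ z≤n) c) , trans (sumℤ-map-+ c) (cong +_ Σc≡s)
  toℕ∘fromℕ : ∀ c → toℕ (fromℕ c) ≡ c
  toℕ∘fromℕ (c , _) = Σ-≡,≡→≡ (trans (sym (map-∘ ∣_∣ +_ c)) (map-id c) , ℕP.≡-irrelevant _ _)
  fromℕ∘toℕ : ∀ v → fromℕ (toℕ v) ≡ v
  fromℕ∘toℕ (v , nonneg , _) = Σ-≡,≡→≡ (map-+-∣∣ nonneg , IsComposition-irrelevant s _ _)

pointLast : ∀ {k} → Vec ℤ (suc k) → ℤ → Vec ℤ (suc (suc k))
pointLast {zero}  (d ∷ []) j = d - j ∷ j ∷ []
pointLast {suc k} (d ∷ ds) j = d ∷ pointLast ds j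

unpointLast : ∀ {k} → Vec ℤ (suc (suc k)) → Vec ℤ (suc k) × ℤ
unpointLast {zero}  (a ∷ j ∷ []) = (a + j ∷ []) , j
unpointLast {suc k} (d ∷ e)      = map₁ (d ∷_) (unpointLast e)

pointLast-↔ : ∀ {k} → (Vec ℤ (suc k) × ℤ) ↔ Vec ℤ (suc (suc k))
pointLast-↔ = mk↔ₛ′ (uncurry pointLast) unpointLast pointLast∘unpointLast unpointLast∘pointLast
  where
  pointLast∘unpointLast : ∀ {k} (e : Vec ℤ (suc (suc k))) → uncurry pointLast (unpointLast e) ≡ e
  pointLast∘unpointLast {zero}  (a ∷ j ∷ []) = cong (λ t → t ∷ j ∷ []) (i+j-j≡i a j)
  pointLast∘unpointLast {suc k} (d ∷ e)      = cong (d ∷_) (pointLast∘unpointLast e)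
  unpointLast∘pointLast : ∀ {k} (p : Vec ℤ (suc k) × ℤ) → unpointLast (uncurry pointLast p) ≡ p
  unpointLast∘pointLast {zero}  ((d ∷ []) , j) = cong (λ t → (t ∷ []) , j) (i-j+j≡i d j)
  unpointLast∘pointLast {suc k} ((d ∷ ds) , j) = cong (map₁ (d ∷_)) (unpointLast∘pointLast (ds , j))

sumℤ-pointLast : ∀ {k} (d : Vec ℤ (suc k)) j → sumℤ (pointLast d j) ≡ sumℤ d
sumℤ-pointLast {zero}  (d ∷ []) j = split-last d j
  where
  split-last : ∀ d j → d - j + (j + 0ℤ) ≡ d + 0ℤ
  split-last = solve-∀
sumℤ-pointLast {suc k} (d ∷ ds) j = cong (_+_ d) (sumℤ-pointLast ds j)

nonneg⇔pointLast-nonneg : ∀ {k} (d : Vec ℤ (suc k)) j →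
                          (All (0ℤ ≤_) d × (0ℤ ≤ j × j ≤ last d)) ⇔ All (0ℤ ≤_) (pointLast d j)
nonneg⇔pointLast-nonneg d j = mk⇔ (split d) (merge d)
  where
  split : ∀ {k} (d : Vec ℤ (suc k)) → All (0ℤ ≤_) d × (0ℤ ≤ j × j ≤ last d) → All (0ℤ ≤_) (pointLast d j)
  split {zero}  (d ∷ []) (_ , 0≤j , j≤d)              = ℤP.i≤j⇒0≤j-i j≤d ∷ 0≤j ∷ []
  split {suc k} (d ∷ ds) ((0≤d ∷ 0≤ds) , 0≤j≤last) = 0≤d ∷ split ds (0≤ds , 0≤j≤last)
  merge : ∀ {k} (d : Vec ℤ (suc k)) → All (0ℤ ≤_) (pointLast d j) → All (0ℤ ≤_) d × (0ℤ ≤ j × j ≤ last d)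
  merge {zero}  (d ∷ []) (0≤d-j ∷ 0≤j ∷ []) =
    (subst (0ℤ ≤_) (i-j+j≡i d j) (ℤP.+-mono-≤ 0≤d-j 0≤j) ∷ []) , 0≤j , ℤP.0≤i-j⇒j≤i 0≤d-j
  merge {suc k} (d ∷ ds) (0≤d ∷ rest) = map₁ (0≤d ∷_) (merge ds rest)

IsPointedComposition : ℕ → ∀ {k} → Vec ℤ (suc k) × ℤ → Set
IsPointedComposition s (d , j) = IsComposition s d × (0ℤ ≤ j × j ≤ last d)

IsPointedComposition-irrelevant : ∀ s {k} {d,j : Vec ℤ (suc k) × ℤ} → Irrelevant (IsPointedComposition s d,j)
IsPointedComposition-irrelevant s = ×-irrelevant (IsComposition-irrelevant s) ≤×≤-irrelevant

pointedComposition↔composition : ∀ s {k} →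
  Σ (Vec ℤ (suc k) × ℤ) (IsPointedComposition s) ↔ Σ (Vec ℤ (suc (suc k))) (IsComposition s)
pointedComposition↔composition s =
  Σ-↔-⇔ (IsPointedComposition-irrelevant s) (IsComposition-irrelevant s) pointLast-↔ (λ {(d , j)} → pointed⇔ d j)
  where
  pointed⇔ : ∀ {k} (d : Vec ℤ (suc k)) j → IsPointedComposition s (d , j) ⇔ IsComposition s (pointLast d j)
  pointed⇔ d j = mk⇔
    (λ ((nonneg , Σd≡s) , bounds) → to (nonneg , bounds) , trans (sumℤ-pointLast d j) Σd≡s)
    (λ (nonneg , Σd≡s) → let (nonneg′ , bounds) = from nonneg
                          in (nonneg′ , trans (sym (sumℤ-pointLast d j)) Σd≡s) , bounds)
    where open Equivalence (nonneg⇔pointLast-nonneg d j)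

ValidHeights : ℕ → ∀ {k} → Vec ℤ k → Set
ValidHeights n ys = All (λ y → 1ℤ - + n ≤ y × y ≤ 1ℤ) ys × sumℤ ys ≡ 1ℤ

ValidPointedWidths : ℕ → ∀ {k} → Vec ℤ (suc k) × ℤ → Set
ValidPointedWidths m (xs , j) =
  (All (λ x → 1ℤ ≤ x × x ≤ + m - 1ℤ) xs × sumℤ xs ≡ + m) × (0ℤ ≤ j × j ≤ last xs - 1ℤ)

ValidHeights-irrelevant : ∀ n {k} {ys : Vec ℤ k} → Irrelevant (ValidHeights n ys)
ValidHeights-irrelevant n = All×≡-irrelevant ≤×≤-irrelevant

ValidPointedWidths-irrelevant : ∀ m {k} {xs,j : Vec ℤ (suc k) × ℤ} → Irrelevant (ValidPointedWidths m xs,j)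
ValidPointedWidths-irrelevant m = ×-irrelevant (All×≡-irrelevant ≤×≤-irrelevant) ≤×≤-irrelevant

pointedLatticePath↔heights×widths : ∀ n m →
  PointedLatticePath n m ↔ (Σ (Vec ℤ (suc n)) (ValidHeights n) × Σ (Vec ℤ (suc n) × ℤ) (ValidPointedWidths m))
pointedLatticePath↔heights×widths n m = begin
  PointedLatticePath n m
    ↔⟨ unpack ⟩
  Σ (Vec (ℤ × ℤ) (suc n) × ℤ) IsPointedPath
    ↔⟨ Σ-↔-⇔ IsPointedPath-irrelevant (×-irrelevant (ValidHeights-irrelevant n) (ValidPointedWidths-irrelevant m)) unzip-↔ (λ {(s , j)} → unzip⇔ s j) ⟩
  Σ (Vec ℤ (suc n) × (Vec ℤ (suc n) × ℤ)) (λ (ys , xs,j) → ValidHeights n ys × ValidPointedWidths m xs,j)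
    ↔⟨ separate ⟩
  (Σ (Vec ℤ (suc n)) (ValidHeights n) × Σ (Vec ℤ (suc n) × ℤ) (ValidPointedWidths m)) ∎
  where
  open EquationalReasoning
  IsPointedPath : Vec (ℤ × ℤ) (suc n) × ℤ → Set
  IsPointedPath (s , j) =
    ((All (λ st → 1ℤ - + n ≤ proj₂ st × proj₂ st ≤ 1ℤ) s × sumℤ (map proj₂ s) ≡ 1ℤ) ×
     (All (λ st → 1ℤ ≤ proj₁ st × proj₁ st ≤ + m - 1ℤ) s × sumℤ (map proj₁ s) ≡ + m)) ×
    (0ℤ ≤ j × j ≤ proj₁ (last s) - 1ℤ)
  IsPointedPath-irrelevant : ∀ {s,j} → Irrelevant (IsPointedPath s,j)
  IsPointedPath-irrelevant =
    ×-irrelevant (×-irrelevant (All×≡-irrelevant ≤×≤-irrelevant) (All×≡-irrelevant ≤×≤-irrelevant)) ≤×≤-irrelevant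
  unpack : PointedLatticePath n m ↔ Σ (Vec (ℤ × ℤ) (suc n) × ℤ) IsPointedPath
  unpack = mk↔ₛ′
    (λ (P , j , bounds) → (steps P , j) , ((y-bound P , y-sum P) , (x-bound P , x-sum P)) , bounds)
    (λ ((s , j) , ((yb , ys) , (xb , xs)) , bounds) →
      record { steps = s ; y-bound = yb ; y-sum = ys ; x-bound = xb ; x-sum = xs } , j , bounds)
    (λ _ → refl) (λ _ → refl)
  unzip⇔ : ∀ s j → IsPointedPath (s , j) ⇔ (ValidHeights n (map proj₂ s) × ValidPointedWidths m (map proj₁ s , j))
  unzip⇔ s j = mk⇔
    (λ (((yb , ysum) , (xb , xsum)) , 0≤j , j≤) →
      (AllP.map⁺ yb , ysum) , (AllP.map⁺ xb , xsum) , 0≤j , subst (λ t → j ≤ t - 1ℤ) (sym (last-map proj₁ s)) j≤)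
    (λ ((yb , ysum) , (xb , xsum) , 0≤j , j≤) →
      ((AllP.map⁻ yb , ysum) , (AllP.map⁻ xb , xsum)) , 0≤j , subst (λ t → j ≤ t - 1ℤ) (last-map proj₁ s) j≤)
  separate : {A B : Set} {P : A → Set} {Q : B → Set} → Σ (A × B) (λ (a , b) → P a × Q b) ↔ (Σ A P × Σ B Q)
  separate = mk↔ₛ′ (λ ((a , b) , p , q) → (a , p) , (b , q)) (λ ((a , p) , (b , q)) → (a , b) , p , q)
    (λ _ → refl) (λ _ → refl)

reflect-↔ : ℤ ↔ ℤ
reflect-↔ = mk↔ₛ′ (1ℤ -_) (1ℤ -_) involutive involutive
  where
  involutive : ∀ y → 1ℤ - (1ℤ - y) ≡ y
  involutive = solve-∀

heights⇔composition : ∀ n (ys : Vec ℤ (suc n)) → ValidHeights n ys ⇔ IsComposition n (map (1ℤ -_) ys)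
heights⇔composition n ys = mk⇔
  (λ (bounds , Σys≡1) → AllP.map⁺ (All.map (ℤP.i≤j⇒0≤j-i ∘ proj₂) bounds) , sum-forth Σys≡1)
  (λ as@(_ , Σas≡n) → All.map bounds (AllP.map⁻ (IsComposition⇒bounded as)) , sum-back Σas≡n)
  where
  open ≡-Reasoning
  N = + n
  [1+i]-1≡i : ∀ i → (1ℤ + i) - 1ℤ ≡ i
  [1+i]-1≡i = solve-∀
  [1+i]-i≡1 : ∀ i → (1ℤ + i) - i ≡ 1ℤ
  [1+i]-i≡1 = solve-∀
  i≡j-[j-i] : ∀ i j → i ≡ j - (j - i)
  i≡j-[j-i] = solve-∀
  i-[j-k]≡k-[j-i] : ∀ i j k → i - (j - k) ≡ k - (j - i)
  i-[j-k]≡k-[j-i] = solve-∀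
  sum-forth : sumℤ ys ≡ 1ℤ → sumℤ (map (1ℤ -_) ys) ≡ N
  sum-forth Σys≡1 = begin
    sumℤ (map (1ℤ -_) ys) ≡⟨ sumℤ-map-1- ys ⟩
    (1ℤ + N) - sumℤ ys    ≡⟨ cong (_-_ (1ℤ + N)) Σys≡1 ⟩
    (1ℤ + N) - 1ℤ         ≡⟨ [1+i]-1≡i N ⟩
    N                     ∎
  sum-back : sumℤ (map (1ℤ -_) ys) ≡ N → sumℤ ys ≡ 1ℤ
  sum-back Σas≡n = begin
    sumℤ ys                         ≡⟨ i≡j-[j-i] (sumℤ ys) (1ℤ + N) ⟩
    (1ℤ + N) - ((1ℤ + N) - sumℤ ys) ≡⟨ cong (_-_ (1ℤ + N)) (trans (sym (sumℤ-map-1- ys)) Σas≡n) ⟩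
    (1ℤ + N) - N                    ≡⟨ [1+i]-i≡1 N ⟩
    1ℤ                              ∎
  bounds : ∀ {y} → 0ℤ ≤ 1ℤ - y × 1ℤ - y ≤ N → 1ℤ - N ≤ y × y ≤ 1ℤ
  bounds {y} (0≤1-y , 1-y≤N) =
    ℤP.0≤i-j⇒j≤i (subst (0ℤ ≤_) (i-[j-k]≡k-[j-i] N 1ℤ y) (ℤP.i≤j⇒0≤j-i 1-y≤N)) , ℤP.0≤i-j⇒j≤i 0≤1-y

heights↔composition : ∀ n → Σ (Vec ℤ (suc n)) (ValidHeights n) ↔ Composition (suc n) n
heights↔composition n = begin
  Σ (Vec ℤ (suc n)) (ValidHeights n)
    ↔⟨ Σ-↔-⇔ (ValidHeights-irrelevant n) (IsComposition-irrelevant n)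
             (map-↔ reflect-↔) (λ {ys} → heights⇔composition n ys) ⟩
  Σ (Vec ℤ (suc n)) (IsComposition n)
    ↔⟨ ℤ-composition↔composition n ⟩
  Composition (suc n) n ∎
  where open EquationalReasoning

shift-↔ : ℤ ↔ ℤ
shift-↔ = mk↔ₛ′ (_- 1ℤ) (_+ 1ℤ) (λ i → i+j-j≡i i 1ℤ) (λ i → i-j+j≡i i 1ℤ)

+[m∸n]≡+m-+n : ∀ {m n} → n ℕ.≤ m → + (m ∸ n) ≡ + m - + n
+[m∸n]≡+m-+n {m} {n} n≤m = sym (trans (ℤP.m-n≡m⊖n m n) (ℤP.⊖-≥ n≤m))

widths⇔pointedComposition : ∀ {n m} → 1 ℕ.≤ n → n ℕ.< m → ∀ (xs : Vec ℤ (suc n)) j →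
  ValidPointedWidths m (xs , j) ⇔ IsPointedComposition (m ∸ suc n) (map (_- 1ℤ) xs , j)
widths⇔pointedComposition {n} {m} 1≤n n<m xs j = mk⇔
  (λ ((bounds , Σxs≡m) , 0≤j , j≤x-1) →
    (AllP.map⁺ (All.map (ℤP.i≤j⇒0≤j-i ∘ proj₁) bounds) , sum-forth Σxs≡m) ,
    0≤j , subst (j ≤_) (sym (last-map (_- 1ℤ) xs)) j≤x-1)
  (λ (ds@(_ , Σds≡s) , 0≤j , j≤d) →
    (All.map bounds (AllP.map⁻ (IsComposition⇒bounded ds)) , sum-back Σds≡s) ,
    0≤j , subst (j ≤_) (last-map (_- 1ℤ) xs) j≤d)
  where
  K = + suc n
  m-K≡m∸K : + m - K ≡ + (m ∸ suc n)
  m-K≡m∸K = sym (+[m∸n]≡+m-+n n<m)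
  sum-forth : sumℤ xs ≡ + m → sumℤ (map (_- 1ℤ) xs) ≡ + (m ∸ suc n)
  sum-forth Σxs≡m = begin
    sumℤ (map (_- 1ℤ) xs) ≡⟨ sumℤ-map-‿-1 xs ⟩
    sumℤ xs - K           ≡⟨ cong (_- K) Σxs≡m ⟩
    + m - K               ≡⟨ m-K≡m∸K ⟩
    + (m ∸ suc n)         ∎
    where open ≡-Reasoning
  sum-back : sumℤ (map (_- 1ℤ) xs) ≡ + (m ∸ suc n) → sumℤ xs ≡ + m
  sum-back Σds≡s = begin
    sumℤ xs             ≡⟨ sym (i-j+j≡i (sumℤ xs) K) ⟩
    sumℤ xs - K + K     ≡⟨ cong (_+ K) (trans (sym (sumℤ-map-‿-1 xs)) (trans Σds≡s (sym m-K≡m∸K))) ⟩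
    + m - K + K         ≡⟨ i-j+j≡i (+ m) K ⟩
    + m                 ∎
    where open ≡-Reasoning
  [m-[1+n]]+1≡m-n : ∀ M N → M - (1ℤ + N) + 1ℤ ≡ M - N
  [m-[1+n]]+1≡m-n = solve-∀
  bounds : ∀ {x} → 0ℤ ≤ x - 1ℤ × x - 1ℤ ≤ + (m ∸ suc n) → 1ℤ ≤ x × x ≤ + m - 1ℤ
  bounds {x} (0≤x-1 , x-1≤m-K) = ℤP.0≤i-j⇒j≤i 0≤x-1 , (begin
    x                    ≡⟨ sym (i-j+j≡i x 1ℤ) ⟩
    x - 1ℤ + 1ℤ          ≤⟨ ℤP.+-monoˡ-≤ 1ℤ (ℤP.≤-trans x-1≤m-K (ℤP.≤-reflexive (sym m-K≡m∸K))) ⟩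
    + m - K + 1ℤ         ≡⟨ [m-[1+n]]+1≡m-n (+ m) (+ n) ⟩
    + m - + n            ≤⟨ ℤP.+-monoʳ-≤ (+ m) (ℤP.neg-mono-≤ (+≤+ 1≤n)) ⟩
    + m - 1ℤ             ∎)
    where open ℤP.≤-Reasoning

widths↔composition : ∀ {n m} → 1 ℕ.≤ n → n ℕ.< m →
  Σ (Vec ℤ (suc n) × ℤ) (ValidPointedWidths m) ↔ Composition (suc (suc n)) (m ∸ suc n)
widths↔composition {n} {m} 1≤n n<m = begin
  Σ (Vec ℤ (suc n) × ℤ) (ValidPointedWidths m)
    ↔⟨ Σ-↔-⇔ (ValidPointedWidths-irrelevant m) (IsPointedComposition-irrelevant s)
             (map-↔ shift-↔ ×-↔ ↔-refl) (λ {(xs , j)} → widths⇔pointedComposition 1≤n n<m xs j) ⟩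
  Σ (Vec ℤ (suc n) × ℤ) (IsPointedComposition s)
    ↔⟨ pointedComposition↔composition s ⟩
  Σ (Vec ℤ (suc (suc n))) (IsComposition s)
    ↔⟨ ℤ-composition↔composition s ⟩
  Composition (suc (suc n)) s ∎
  where
  open EquationalReasoning
  s = m ∸ suc n

lemma3p2 : (n m : ℕ) → 1 ℕ.≤ n → n ℕ.+ 1 ℕ.≤ m →
    PointedLatticePath n m ↔ Fin (((2 ℕ.* n) C n) ℕ.* (m C (n ℕ.+ 1)))
lemma3p2 n m 1≤n n+1≤m = begin
  PointedLatticePath n m
    ↔⟨ pointedLatticePath↔heights×widths n m ⟩
  (Σ (Vec ℤ (suc n)) (ValidHeights n) × Σ (Vec ℤ (suc n) × ℤ) (ValidPointedWidths m))
    ↔⟨ heights↔composition n ×-↔ widths↔composition 1≤n n<m ⟩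
  (Composition (suc n) n × Composition (suc (suc n)) (m ∸ suc n))
    ↔⟨ composition-count n n ×-↔ composition-count (suc n) (m ∸ suc n) ⟩
  (Fin ((n ℕ.+ n) C n) × Fin ((m ∸ suc n ℕ.+ suc n) C suc n))
    ↔⟨ *↔× ⟨
  Fin (((n ℕ.+ n) C n) ℕ.* ((m ∸ suc n ℕ.+ suc n) C suc n))
    ≡⟨ cong Fin binomials ⟩
  Fin (((2 ℕ.* n) C n) ℕ.* (m C (n ℕ.+ 1))) ∎
  where
  open EquationalReasoning
  n<m : n ℕ.< m
  n<m = subst (ℕ._≤ m) (ℕP.+-comm n 1) n+1≤m
  binomials : ((n ℕ.+ n) C n) ℕ.* ((m ∸ suc n ℕ.+ suc n) C suc n) ≡ ((2 ℕ.* n) C n) ℕ.* (m C (n ℕ.+ 1))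
  binomials = cong₂ (λ a b → (a C n) ℕ.* b)
    (cong (n ℕ.+_) (sym (ℕP.+-identityʳ n)))
    (cong₂ _C_ (ℕP.m∸n+n≡m n<m) (ℕP.+-comm 1 n))
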